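{- Let $t\in\mathbb{N}$ and let $\mathscr D$ be a graph class of bounded shrubdepth such that no member of $\mathscr D$ contains $K_{t,t}$ as an induced subgraph. Then $\mathscr D$ has bounded subchromatic number.
   Context: A connection model of a graph $G$ consists of a finite label set $\Lambda$, a labelling $\lambda\colon V(G)\to\Lambda$, a rooted tree $T$ whose leaf set is $V(G)$, and for each non-leaf node $x$ of $T$ a symmetric relation $M_x\subseteq\Lambda\times\Lambda$, such that distinct $u,v$ are adjacent in $G$ iff $(\lambda(u),\lambda(v))\in M_x$ where $x$ is the lowest common ancestor of $u,v$ in $T$. Its depth is the maximum number of nodes on a root-to-leaf path of $T$. A class $\mathscr D$ has bounded shrubdepth if there exist $d,m\in\mathbb{N}$ such that every member of $\mathscr D$ admits a connection model of depth at most $d$ with at most $m$ labels. A cluster graph is a graph whose every component is a clique; a subcoloring of $G$ is a map $\lambda\colon V(G)\to C$ with $G[\lambda^{ -1}(i)]$ a cluster graph for each $i$; the subchromatic number is the minimum number of colors of a subcoloring; a class has bounded subchromatic number if some constant bounds it on all members. -}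

module Defs where

open import Data.Nat using (ℕ; suc; _⊔_; _≤_)
open import Data.Fin using (Fin)
open import Data.Bool using (Bool; true; false)
open import Data.List using (List; []; _∷_; _++_; length; lookup; allFin)
open import Data.List.Membership.Propositional using (_∈_)
open import Data.List.Relation.Binary.Permutation.Propositional using (_↭_)
open import Data.Product using (Σ; ∃; ∃-syntax; _×_; _,_)
open import Data.Sum using (_⊎_)
open import Relation.Nullary using (¬_)
open import Relation.Binary.PropositionalEquality using (_≡_; _≢_)
open import Function.Bundles using (_⇔_)

record Graph : Set where
  field
    n      : ℕ
    adj    : Fin n → Fin n → Bool
    sym    : ∀ u v → adj u v ≡ adj v u
    irrefl : ∀ u → adj u u ≡ false

open Graph public

GraphClass : Set₁
GraphClass = Graph → Set

data RTree (V Λ : Set) : Set where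
  leaf : V → RTree V Λ
  node : (Λ → Λ → Bool) → List (RTree V Λ) → RTree V Λ

module _ {V Λ : Set} where

  mutual
    leaves : RTree V Λ → List V
    leaves (leaf v)    = v ∷ []
    leaves (node _ ts) = leavesList ts

    leavesList : List (RTree V Λ) → List V
    leavesList []       = []
    leavesList (t ∷ ts) = leaves t ++ leavesList ts

  -- depth = maximum number of nodes on a root-to-leaf path
  mutual
    depth : RTree V Λ → ℕ
    depth (leaf _)    = 1
    depth (node _ ts) = suc (depthList ts)

    depthList : List (RTree V Λ) → ℕ
    depthList []       = 0
    depthList (t ∷ ts) = depth t ⊔ depthList ts

  data WellFormed : RTree V Λ → Set where
    wf-leaf : ∀ v → WellFormed (leaf v)
    wf-node : ∀ M t ts →
              (∀ a b → M a b ≡ M b a) →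
              (∀ i → WellFormed (lookup (t ∷ ts) i)) →
              WellFormed (node M (t ∷ ts))

  data LCA : RTree V Λ → V → V → (Λ → Λ → Bool) → Set where
    lca-here  : ∀ {M ts u v} (i j : Fin (length ts)) → i ≢ j →
                u ∈ leaves (lookup ts i) → v ∈ leaves (lookup ts j) →
                LCA (node M ts) u v M
    lca-below : ∀ {M ts u v M′} (i : Fin (length ts)) →
                LCA (lookup ts i) u v M′ →
                LCA (node M ts) u v M′

record ConnectionModel (G : Graph) (Λ : Set) : Set₁ where
  field
    label      : Fin (n G) → Λ
    tree       : RTree (Fin (n G)) Λ
    wellFormed : WellFormed tree
    leafSet    : leaves tree ↭ allFin (n G)
    correct    : ∀ u v → u ≢ v → ∀ M → LCA tree u v M →
                 (adj G u v ≡ true ⇔ M (label u) (label v) ≡ true)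

open ConnectionModel public

-- label set of size at most m is represented by Fin m
BoundedShrubdepth : GraphClass → Set₁
BoundedShrubdepth 𝒟 =
  Σ ℕ λ d → Σ ℕ λ m → ∀ G → 𝒟 G →
    Σ (ConnectionModel G (Fin m)) λ CM → depth (tree CM) ≤ d

ContainsInducedKtt : ℕ → Graph → Set
ContainsInducedKtt t G =
  Σ (Fin t → Fin (n G)) λ a → Σ (Fin t → Fin (n G)) λ b →
    (∀ i j → a i ≡ a j → i ≡ j) ×
    (∀ i j → b i ≡ b j → i ≡ j) ×
    (∀ i j → a i ≢ b j) ×
    (∀ i j → adj G (a i) (a j) ≡ false) ×
    (∀ i j → adj G (b i) (b j) ≡ false) ×
    (∀ i j → adj G (a i) (b j) ≡ true)

data ReachIn (G : Graph) {C : Set} (col : Fin (n G) → C) (i : C) :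
             Fin (n G) → Fin (n G) → Set where
  here : ∀ {u} → col u ≡ i → ReachIn G col i u u
  step : ∀ {u v w} → col u ≡ i → adj G u v ≡ true →
         ReachIn G col i v w → ReachIn G col i u w

IsClusterClass : (G : Graph) {C : Set} → (Fin (n G) → C) → C → Set
IsClusterClass G col i =
  ∀ u v → ReachIn G col i u v → u ≢ v → adj G u v ≡ true

IsSubcoloring : (G : Graph) {C : Set} → (Fin (n G) → C) → Set
IsSubcoloring G col = ∀ i → IsClusterClass G col i

BoundedSubchromatic : GraphClass → Set
BoundedSubchromatic 𝒟 =
  Σ ℕ λ k → ∀ G → 𝒟 G → Σ (Fin (n G) → Fin k) λ col → IsSubcoloring G col

{-# OPTIONS --safe #-}
-- Fix a label a. On the a-labelled vertices the connection model is a cotree: the a-vertices in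
-- different children of a node x are all adjacent when M_x(a,a) holds (a join) and all non-adjacent
-- otherwise (a union). So the independence number α of a subtree is the maximum over the children
-- at a join and the sum at a union, and the a-vertices of a subtree split into α cliques.
-- Colour an a-vertex v by (a, h, c): h is the height of the highest join on the root-to-v path
-- whose child s containing v has α(s) < t, and c is the index of v's clique in s ((0, 0) if there
-- is no such join); there are at most m (d + 1) (t + 1) colours.
-- Let u – v – w be a path in one colour class and look at the node where the three vertices
-- separate. If u and w lie in different children, one of them is also separated from its neighbour
-- v, so the node is a join and u ~ w. If only v lies in another child, the node is a join; two
-- children of a join with α ≥ t would span an induced K_{t,t}, and a child where the colouring does
-- not stop only produces smaller heights, so the child of u and w stops here and u, w receive the
-- same clique index, hence u ~ w. Every colour class is therefore P₃-free, i.e. a cluster graph.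
module Submission where

open import Defs
open import Data.Nat using (ℕ)
open import Relation.Nullary using (¬_)

open import Data.Bool using (Bool; true; false)
open import Data.Bool.Properties using (⇔→≡)
import Data.Bool.Properties as Bool
open import Data.Empty using (⊥-elim)
open import Data.Fin using (Fin; zero; suc; fromℕ<; inject≤; combine)
open import Data.Fin.Properties using (suc-injective; fromℕ<-injective; inject≤-injective; combine-injective)
import Data.Fin.Properties as Fin
open import Data.List using (List; []; _∷_; _++_; length; lookup)
open import Data.List.Properties using (length-++)
open import Data.List.Membership.Propositional using (_∈_; _∉_)
open import Data.List.Membership.Propositional.Properties using (∈-++⁺ˡ; ∈-++⁺ʳ; ∈-++⁻; ∈-lookup; ∈-allFin)
open import Data.List.Relation.Unary.Any using (here; there)
import Data.List.Relation.Unary.All as All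
open All using ([])
import Data.List.Relation.Unary.All.Properties as All
open import Data.List.Relation.Unary.Unique.Propositional using (Unique; []; _∷_)
import Data.List.Relation.Unary.Unique.Propositional.Properties as Unique
open import Data.List.Relation.Binary.Disjoint.Propositional using (Disjoint)
open import Data.List.Relation.Binary.Permutation.Propositional using (↭-sym; ↭⇒↭ₛ)
open import Data.List.Relation.Binary.Permutation.Propositional.Properties using (∈-resp-↭)
import Data.List.Relation.Binary.Permutation.Setoid.Properties as Permutation
open import Data.Nat using (zero; suc; _+_; _*_; _⊔_; _≤_; _<_; _<?_; z≤n; s≤s)
open import Data.Nat.Properties
  using (≤-refl; ≤-trans; ≤-reflexive; <⇒≤; <-≤-trans; <-trans; <⇒≱; ≮⇒≥; 1+n≰n; m≤n⇒m≤1+n;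
         m≤m⊔n; m≤n⊔m; ⊔-sel; m≤m+n; +-monoʳ-<; +-mono-≤; +-cancelˡ-≡)
open import Data.Product using (∃-syntax; _×_; _,_; proj₁; proj₂)
open import Data.Product.Properties using (,-injectiveˡ; ,-injectiveʳ)
open import Data.Sum using (inj₁; inj₂; [_,_]′)
open import Data.Unit using (⊤; tt)
open import Relation.Nullary using (Dec; yes; no; contradiction)
open import Relation.Nullary.Decidable using (_×-dec_; map′)
open import Relation.Binary using (DecidableEquality)
open import Relation.Binary.PropositionalEquality as ≡ using (_≡_; _≢_; refl; trans; cong; cong₂; subst)
import Relation.Binary.PropositionalEquality.Properties as ≡
open import Function.Bundles using (_⇔_)

module _ {A : Set} where

  Unique-++⁻ˡ : ∀ xs {ys : List A} → Unique (xs ++ ys) → Unique xs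
  Unique-++⁻ˡ []       _        = []
  Unique-++⁻ˡ (x ∷ xs) (x∉ ∷ u) = All.++⁻ˡ xs x∉ ∷ Unique-++⁻ˡ xs u

  Unique-++⁻ʳ : ∀ xs {ys : List A} → Unique (xs ++ ys) → Unique ys
  Unique-++⁻ʳ []       u       = u
  Unique-++⁻ʳ (x ∷ xs) (_ ∷ u) = Unique-++⁻ʳ xs u

  Unique-++⇒Disjoint : ∀ xs {ys : List A} → Unique (xs ++ ys) → Disjoint xs ys
  Unique-++⇒Disjoint []       _        (() , _)
  Unique-++⇒Disjoint (x ∷ xs) (x∉ ∷ _) (here refl , x∈ys) = All.lookup x∉ (∈-++⁺ʳ xs x∈ys) refl
  Unique-++⇒Disjoint (x ∷ xs) (_ ∷ u)  (there v∈xs , v∈ys) = Unique-++⇒Disjoint xs u (v∈xs , v∈ys)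

  ∈-++⁻ʳ : ∀ (xs : List A) {ys v} → v ∉ xs → v ∈ xs ++ ys → v ∈ ys
  ∈-++⁻ʳ xs v∉xs v∈ with ∈-++⁻ xs v∈
  ... | inj₁ v∈xs = contradiction v∈xs v∉xs
  ... | inj₂ v∈ys = v∈ys

  lookup-injective : ∀ {xs : List A} → Unique xs → ∀ i j → lookup xs i ≡ lookup xs j → i ≡ j
  lookup-injective (x∉ ∷ u) zero    zero    _ = refl
  lookup-injective (x∉ ∷ u) zero    (suc j) e = contradiction e (All.lookup x∉ (∈-lookup j))
  lookup-injective (x∉ ∷ u) (suc i) zero    e = contradiction (≡.sym e) (All.lookup x∉ (∈-lookup i))
  lookup-injective (x∉ ∷ u) (suc i) (suc j) e = cong suc (lookup-injective u i j e)

module _ {V Λ : Set} where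

  RTree-ind : (P : RTree V Λ → Set) → (∀ v → P (leaf v)) →
              (∀ M ts → (∀ i → P (lookup ts i)) → P (node M ts)) → ∀ s → P s
  RTree-ind P P-leaf P-node = go
    where
    mutual
      go : ∀ s → P s
      go (leaf v)    = P-leaf v
      go (node M ts) = P-node M ts (goChildren ts)

      goChildren : ∀ ts (i : Fin (length ts)) → P (lookup ts i)
      goChildren (s ∷ ts) zero    = go s
      goChildren (s ∷ ts) (suc i) = goChildren ts i

  childContaining : ∀ (ts : List (RTree V Λ)) {v} → v ∈ leavesList ts → ∃[ i ] v ∈ leaves (lookup ts i)
  childContaining (s ∷ ts) v∈ with ∈-++⁻ (leaves s) v∈
  ... | inj₁ v∈s  = zero , v∈s
  ... | inj₂ v∈ts with childContaining ts v∈ts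
  ...   | i , v∈i = suc i , v∈i

  ∈-leavesList⁺ : ∀ (ts : List (RTree V Λ)) i {v} → v ∈ leaves (lookup ts i) → v ∈ leavesList ts
  ∈-leavesList⁺ (s ∷ ts) zero    v∈ = ∈-++⁺ˡ v∈
  ∈-leavesList⁺ (s ∷ ts) (suc i) v∈ = ∈-++⁺ʳ (leaves s) (∈-leavesList⁺ ts i v∈)

  depth-lookup : ∀ (ts : List (RTree V Λ)) i → depth (lookup ts i) ≤ depthList ts
  depth-lookup (s ∷ ts) zero    = m≤m⊔n (depth s) _
  depth-lookup (s ∷ ts) (suc i) = ≤-trans (depth-lookup ts i) (m≤n⊔m (depth s) _)

  LCA-∷ : ∀ {M s ts u v M′} → LCA (node M ts) u v M′ → LCA {V} {Λ} (node M (s ∷ ts)) u v M′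
  LCA-∷ (lca-here i j i≢j u∈ v∈) = lca-here (suc i) (suc j) (λ e → i≢j (suc-injective e)) u∈ v∈
  LCA-∷ (lca-below i lca)         = lca-below (suc i) lca

  Unique-lookup : ∀ (ts : List (RTree V Λ)) → Unique (leavesList ts) → ∀ i → Unique (leaves (lookup ts i))
  Unique-lookup (s ∷ ts) u zero    = Unique-++⁻ˡ (leaves s) u
  Unique-lookup (s ∷ ts) u (suc i) = Unique-lookup ts (Unique-++⁻ʳ (leaves s) u) i

  Disjoint-lookup : ∀ (ts : List (RTree V Λ)) → Unique (leavesList ts) → ∀ {i j} → i ≢ j →
                    Disjoint (leaves (lookup ts i)) (leaves (lookup ts j))
  Disjoint-lookup (s ∷ ts) u {zero}  {zero}  i≢j _ = i≢j refl
  Disjoint-lookup (s ∷ ts) u {zero}  {suc j} _ (v∈s , v∈j) =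
    Unique-++⇒Disjoint (leaves s) u (v∈s , ∈-leavesList⁺ ts j v∈j)
  Disjoint-lookup (s ∷ ts) u {suc i} {zero}  _ (v∈i , v∈s) =
    Unique-++⇒Disjoint (leaves s) u (v∈s , ∈-leavesList⁺ ts i v∈i)
  Disjoint-lookup (s ∷ ts) u {suc i} {suc j} i≢j =
    Disjoint-lookup ts (Unique-++⁻ʳ (leaves s) u) (λ i≡j → i≢j (cong suc i≡j))

module _ (G : Graph) where

  adj⇒≢ : ∀ {u v} → adj G u v ≡ true → u ≢ v
  adj⇒≢ {u} uv refl with trans (≡.sym uv) (irrefl G u)
  ... | ()

  P₃FreeOn : {C : Set} → (Fin (n G) → Set) → (Fin (n G) → C) → Set
  P₃FreeOn P col = ∀ {u v w} → P u → P v → P w → col u ≡ col v → col w ≡ col v →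
                   adj G u v ≡ true → adj G v w ≡ true → u ≢ w → adj G u w ≡ true

  P₃Free : {C : Set} → (Fin (n G) → C) → Set
  P₃Free = P₃FreeOn (λ _ → ⊤)

  P₃Free-refine : {C D : Set} {f : Fin (n G) → C} {g : Fin (n G) → D} →
                  (∀ {u v} → f u ≡ f v → g u ≡ g v) → P₃Free g → P₃Free f
  P₃Free-refine f⇒g P₃ _ _ _ uv wv = P₃ tt tt tt (f⇒g uv) (f⇒g wv)

  P₃Free⇒IsSubcoloring : {C : Set} {col : Fin (n G) → C} → P₃Free col → IsSubcoloring G col
  P₃Free⇒IsSubcoloring {col = col} P₃ i = go
    where
    start : ∀ {u v} → ReachIn G col i u v → col u ≡ i
    start (here cu)     = cu
    start (step cu _ _) = cu

    end : ∀ {u v} → ReachIn G col i u v → col v ≡ i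
    end (here cv)     = cv
    end (step _ _ r) = end r

    go : ∀ u w → ReachIn G col i u w → u ≢ w → adj G u w ≡ true
    go u .u (here _) u≢u = contradiction refl u≢u
    go u w (step {v = v} cu uv r) u≢w with v Fin.≟ w
    ... | yes refl = uv
    ... | no v≢w   = P₃ tt tt tt (trans cu (≡.sym (start r))) (trans (end r) (≡.sym (start r)))
                       uv (go v w r v≢w) u≢w

  Independent : List (Fin (n G)) → Set
  Independent I = ∀ {x y} → x ∈ I → y ∈ I → adj G x y ≡ false

  completeBipartite⇒Ktt : ∀ t {A B} → Unique A → Unique B → Independent A → Independent B →
                          (∀ {x y} → x ∈ A → y ∈ B → adj G x y ≡ true) →
                          t ≤ length A → t ≤ length B → ContainsInducedKtt t G
  completeBipartite⇒Ktt t {A} {B} uA uB indA indB complete t≤A t≤B =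
    a , b , a-injective , b-injective , (λ i j → adj⇒≢ (complete (a∈ i) (b∈ j))) ,
    (λ i j → indA (a∈ i) (a∈ j)) , (λ i j → indB (b∈ i) (b∈ j)) , (λ i j → complete (a∈ i) (b∈ j))
    where
    a b : Fin t → Fin (n G)
    a i = lookup A (inject≤ i t≤A)
    b i = lookup B (inject≤ i t≤B)
    a∈ : ∀ i → a i ∈ A
    a∈ i = ∈-lookup (inject≤ i t≤A)
    b∈ : ∀ i → b i ∈ B
    b∈ i = ∈-lookup (inject≤ i t≤B)
    a-injective : ∀ i j → a i ≡ a j → i ≡ j
    a-injective i j e = inject≤-injective t≤A t≤A i j (lookup-injective uA _ _ e)
    b-injective : ∀ i j → b i ≡ b j → i ≡ j
    b-injective i j e = inject≤-injective t≤B t≤B i j (lookup-injective uB _ _ e)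

module Model (G : Graph) {Λ : Set} (_≟_ : DecidableEquality Λ) (lab : Fin (n G) → Λ) where

  open import Data.List.Membership.DecPropositional (Fin._≟_ {n G}) using (_∈?_)

  V : Set
  V = Fin (n G)

  Tree : Set
  Tree = RTree V Λ

  record IsModel (s : Tree) : Set where
    field
      lca-correct   : ∀ u v → u ≢ v → ∀ M → LCA s u v M →
                      (adj G u v ≡ true ⇔ M (lab u) (lab v) ≡ true)
      leaves-unique : Unique (leaves s)

  open IsModel

  IsModel-lookup : ∀ {M ts} → IsModel (node M ts) → ∀ i → IsModel (lookup ts i)
  IsModel-lookup {ts = ts} m i = record
    { lca-correct   = λ u v u≢v M′ lca → lca-correct m u v u≢v M′ (lca-below i lca)
    ; leaves-unique = Unique-lookup ts (leaves-unique m) i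
    }

  IsModel-tail : ∀ {M s ts} → IsModel (node M (s ∷ ts)) → IsModel (node M ts)
  IsModel-tail {s = s} m = record
    { lca-correct   = λ u v u≢v M′ lca → lca-correct m u v u≢v M′ (LCA-∷ lca)
    ; leaves-unique = Unique-++⁻ʳ (leaves s) (leaves-unique m)
    }

  adj-across : ∀ {M ts} → IsModel (node M ts) → ∀ {i j} → i ≢ j → ∀ {u w} →
               u ∈ leaves (lookup ts i) → w ∈ leaves (lookup ts j) → adj G u w ≡ M (lab u) (lab w)
  adj-across {ts = ts} m {i} {j} i≢j u∈ w∈ =
    ⇔→≡ (lca-correct m _ _ (λ { refl → Disjoint-lookup ts (leaves-unique m) i≢j (u∈ , w∈) }) _
          (lca-here i j i≢j u∈ w∈))

  adj-head-tail : ∀ {M s ts} → IsModel (node M (s ∷ ts)) → ∀ {u w} →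
                  u ∈ leaves s → w ∈ leavesList ts → adj G u w ≡ M (lab u) (lab w)
  adj-head-tail {ts = ts} m u∈ w∈ with childContaining ts w∈
  ... | i , w∈i = adj-across m {zero} {suc i} (λ ()) u∈ w∈i

  module LabelClass (a : Λ) where

    _∈ₐ_ : V → Tree → Set
    v ∈ₐ s = v ∈ leaves s × lab v ≡ a

    adj-acrossₐ : ∀ {M ts} → IsModel (node M ts) → ∀ {i j} → i ≢ j → ∀ {u w} →
                  u ∈ₐ lookup ts i → w ∈ₐ lookup ts j → adj G u w ≡ M a a
    adj-acrossₐ {M} m i≢j (u∈ , lu) (w∈ , lw) = trans (adj-across m i≢j u∈ w∈) (cong₂ M lu lw)

    adj-head-tailₐ : ∀ {M s ts} → IsModel (node M (s ∷ ts)) → ∀ {u w} →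
                     u ∈ leaves s → w ∈ leavesList ts → lab u ≡ a → lab w ≡ a → adj G u w ≡ M a a
    adj-head-tailₐ {M} m u∈ w∈ lu lw = trans (adj-head-tail m u∈ w∈) (cong₂ M lu lw)

    mutual
      α : Tree → ℕ
      α (leaf u) with lab u ≟ a
      ... | yes _ = 1
      ... | no  _ = 0
      α (node M ts) = αs (M a a) ts

      αs : Bool → List Tree → ℕ
      αs _     []       = 0
      αs true  (s ∷ ts) = α s ⊔ αs true ts
      αs false (s ∷ ts) = α s + αs false ts

    -- Below a join node (M a a ≡ true) cliques of different children merge; below a union they are
    -- numbered consecutively.
    offset : Bool → ℕ → ℕ
    offset true  _ = 0
    offset false k = k

    mutual
      cliqueIndex : Tree → V → ℕ
      cliqueIndex (leaf _)    _ = 0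
      cliqueIndex (node M ts) v = cliqueIndices (M a a) ts v

      cliqueIndices : Bool → List Tree → V → ℕ
      cliqueIndices _ []       _ = 0
      cliqueIndices b (s ∷ ts) v with v ∈? leaves s
      ... | yes _ = cliqueIndex s v
      ... | no  _ = offset b (α s) + cliqueIndices b ts v

    mutual
      cliqueIndex<α : ∀ s {v} → v ∈ leaves s → lab v ≡ a → cliqueIndex s v < α s
      cliqueIndex<α (leaf u) (here refl) lu with lab u ≟ a
      ... | yes _  = s≤s z≤n
      ... | no ¬lu = contradiction lu ¬lu
      cliqueIndex<α (node M ts) v∈ lv = cliqueIndices<αs (M a a) ts v∈ lv

      cliqueIndices<αs : ∀ b ts {v} → v ∈ leavesList ts → lab v ≡ a → cliqueIndices b ts v < αs b ts
      cliqueIndices<αs true (s ∷ ts) {v} v∈ lv with v ∈? leaves s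
      ... | yes v∈s = <-≤-trans (cliqueIndex<α s v∈s lv) (m≤m⊔n _ _)
      ... | no  v∉s = <-≤-trans (cliqueIndices<αs true ts (∈-++⁻ʳ (leaves s) v∉s v∈) lv) (m≤n⊔m _ _)
      cliqueIndices<αs false (s ∷ ts) {v} v∈ lv with v ∈? leaves s
      ... | yes v∈s = <-≤-trans (cliqueIndex<α s v∈s lv) (m≤m+n _ _)
      ... | no  v∉s = +-monoʳ-< (α s) (cliqueIndices<αs false ts (∈-++⁻ʳ (leaves s) v∉s v∈) lv)

    sameCliqueIndex-head-tail⇒adj :
      ∀ {M s ts b} → M a a ≡ b → IsModel (node M (s ∷ ts)) → ∀ {u w} →
      u ∈ leaves s → w ∈ leavesList ts → lab u ≡ a → lab w ≡ a →
      cliqueIndex s u ≡ offset b (α s) + cliqueIndices b ts w → adj G u w ≡ true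
    sameCliqueIndex-head-tail⇒adj {b = true} Maa m u∈ w∈ lu lw _ = trans (adj-head-tailₐ m u∈ w∈ lu lw) Maa
    sameCliqueIndex-head-tail⇒adj {s = s} {b = false} _ _ u∈ _ lu _ e =
      contradiction (≤-trans (m≤m+n (α s) _) (≤-reflexive (≡.sym e))) (<⇒≱ (cliqueIndex<α s u∈ lu))

    mutual
      sameCliqueIndex⇒adj : ∀ s → IsModel s → ∀ {u w} → u ∈ₐ s → w ∈ₐ s →
                            cliqueIndex s u ≡ cliqueIndex s w → u ≢ w → adj G u w ≡ true
      sameCliqueIndex⇒adj (leaf _) _ (here refl , _) (here refl , _) _ u≢w = contradiction refl u≢w
      sameCliqueIndex⇒adj (node M ts) m (u∈ , lu) (w∈ , lw) = sameCliqueIndices⇒adj M ts refl m u∈ w∈ lu lw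

      sameCliqueIndices⇒adj : ∀ M ts {b} → M a a ≡ b → IsModel (node M ts) → ∀ {u w} →
                              u ∈ leavesList ts → w ∈ leavesList ts → lab u ≡ a → lab w ≡ a →
                              cliqueIndices b ts u ≡ cliqueIndices b ts w → u ≢ w → adj G u w ≡ true
      sameCliqueIndices⇒adj M (s ∷ ts) {b} Maa m {u} {w} u∈ w∈ lu lw e u≢w
        with u ∈? leaves s | w ∈? leaves s
      ... | yes u∈s | yes w∈s = sameCliqueIndex⇒adj s (IsModel-lookup m zero) (u∈s , lu) (w∈s , lw) e u≢w
      ... | yes u∈s | no  w∉s =
        sameCliqueIndex-head-tail⇒adj Maa m u∈s (∈-++⁻ʳ (leaves s) w∉s w∈) lu lw e
      ... | no  u∉s | yes w∈s = trans (Graph.sym G u w)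
        (sameCliqueIndex-head-tail⇒adj Maa m w∈s (∈-++⁻ʳ (leaves s) u∉s u∈) lw lu (≡.sym e))
      ... | no  u∉s | no  w∉s =
        sameCliqueIndices⇒adj M ts Maa (IsModel-tail m) (∈-++⁻ʳ (leaves s) u∉s u∈)
          (∈-++⁻ʳ (leaves s) w∉s w∈) lu lw (+-cancelˡ-≡ (offset b (α s)) _ _ e) u≢w

    record IndependentSetIn (L : List V) (k : ℕ) : Set where
      field
        members     : List V
        unique      : Unique members
        included    : ∀ {x} → x ∈ members → x ∈ L
        labelled    : ∀ {x} → x ∈ members → lab x ≡ a
        independent : Independent G members
        large       : k ≤ length members

    open IndependentSetIn

    ∅-independentSetIn : ∀ {L} → IndependentSetIn L 0
    ∅-independentSetIn = record
      { members = [] ; unique = [] ; included = λ () ; labelled = λ () ; independent = λ () ; large = z≤n }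

    weaken : ∀ {L L′ k k′} → (∀ {x} → x ∈ L → x ∈ L′) → k′ ≤ k →
             IndependentSetIn L k → IndependentSetIn L′ k′
    weaken L⊆L′ k′≤k I = record
      { members = members I ; unique = unique I ; included = λ x∈ → L⊆L′ (included I x∈)
      ; labelled = labelled I ; independent = independent I ; large = ≤-trans k′≤k (large I) }

    union : ∀ {L₁ L₂ k₁ k₂} → Disjoint L₁ L₂ →
            (∀ {x y} → x ∈ L₁ → y ∈ L₂ → lab x ≡ a → lab y ≡ a → adj G x y ≡ false) →
            IndependentSetIn L₁ k₁ → IndependentSetIn L₂ k₂ → IndependentSetIn (L₁ ++ L₂) (k₁ + k₂)
    union {L₁} disjoint nonadjacent I₁ I₂ = record
      { members     = members I₁ ++ members I₂
      ; unique      = Unique.++⁺ (unique I₁) (unique I₂)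
                        (λ (x∈₁ , x∈₂) → disjoint (included I₁ x∈₁ , included I₂ x∈₂))
      ; included    = λ x∈ → [ (λ x∈₁ → ∈-++⁺ˡ (included I₁ x∈₁))
                               , (λ x∈₂ → ∈-++⁺ʳ L₁ (included I₂ x∈₂)) ]′ (∈-++⁻ (members I₁) x∈)
      ; labelled    = λ x∈ → [ labelled I₁ , labelled I₂ ]′ (∈-++⁻ (members I₁) x∈)
      ; independent = independent₁₂
      ; large       = ≤-trans (+-mono-≤ (large I₁) (large I₂))
                              (≤-reflexive (≡.sym (length-++ (members I₁))))
      }
      where
      across : ∀ {x y} → x ∈ members I₁ → y ∈ members I₂ → adj G x y ≡ false
      across x∈ y∈ = nonadjacent (included I₁ x∈) (included I₂ y∈) (labelled I₁ x∈) (labelled I₂ y∈)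

      independent₁₂ : Independent G (members I₁ ++ members I₂)
      independent₁₂ x∈ y∈ with ∈-++⁻ (members I₁) x∈ | ∈-++⁻ (members I₁) y∈
      ... | inj₁ x∈₁ | inj₁ y∈₁ = independent I₁ x∈₁ y∈₁
      ... | inj₁ x∈₁ | inj₂ y∈₂ = across x∈₁ y∈₂
      ... | inj₂ x∈₂ | inj₁ y∈₁ = trans (Graph.sym G _ _) (across y∈₁ x∈₂)
      ... | inj₂ x∈₂ | inj₂ y∈₂ = independent I₂ x∈₂ y∈₂

    mutual
      independentSetIn-α : ∀ s → IsModel s → IndependentSetIn (leaves s) (α s)
      independentSetIn-α (leaf u) _ with lab u ≟ a
      ... | yes lu = record
        { members = u ∷ [] ; unique = [] ∷ [] ; included = λ x∈ → x∈ ; labelled = λ { (here refl) → lu }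
        ; independent = λ { (here refl) (here refl) → irrefl G u } ; large = ≤-refl }
      ... | no _ = ∅-independentSetIn
      independentSetIn-α (node M ts) m = independentSetIn-αs M ts refl m

      independentSetIn-αs : ∀ M ts {b} → M a a ≡ b → IsModel (node M ts) →
                            IndependentSetIn (leavesList ts) (αs b ts)
      independentSetIn-αs M []       _ _ = ∅-independentSetIn
      independentSetIn-αs M (s ∷ ts) {true} Maa m with ⊔-sel (α s) (αs true ts)
      ... | inj₁ e = weaken ∈-++⁺ˡ (≤-reflexive e) (independentSetIn-α s (IsModel-lookup m zero))
      ... | inj₂ e =
        weaken (∈-++⁺ʳ (leaves s)) (≤-reflexive e) (independentSetIn-αs M ts Maa (IsModel-tail m))
      independentSetIn-αs M (s ∷ ts) {false} Maa m =
        union (Unique-++⇒Disjoint (leaves s) (leaves-unique m))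
              (λ x∈ y∈ lx ly → trans (adj-head-tailₐ m x∈ y∈ lx ly) Maa)
              (independentSetIn-α s (IsModel-lookup m zero))
              (independentSetIn-αs M ts Maa (IsModel-tail m))

    large-join-children⇒Ktt : ∀ t {M ts} → IsModel (node M ts) → M a a ≡ true → ∀ {i j} → i ≢ j →
                               t ≤ α (lookup ts i) → t ≤ α (lookup ts j) → ContainsInducedKtt t G
    large-join-children⇒Ktt t {ts = ts} m Maa {i} {j} i≢j t≤αᵢ t≤αⱼ =
      completeBipartite⇒Ktt G t (unique I) (unique J) (independent I) (independent J)
        (λ x∈ y∈ → trans (adj-acrossₐ m i≢j (included I x∈ , labelled I x∈) (included J y∈ , labelled J y∈))
                         Maa)
        (≤-trans t≤αᵢ (large I)) (≤-trans t≤αⱼ (large J))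
      where
      I : IndependentSetIn (leaves (lookup ts i)) (α (lookup ts i))
      I = independentSetIn-α (lookup ts i) (IsModel-lookup m i)
      J : IndependentSetIn (leaves (lookup ts j)) (α (lookup ts j))
      J = independentSetIn-α (lookup ts j) (IsModel-lookup m j)

  module Colouring (t : ℕ) (Ktt-free : ¬ ContainsInducedKtt t G) (a : Λ) where

    open LabelClass a

    record Stops (b : Bool) (s : Tree) : Set where
      constructor stops
      field
        joined : b ≡ true
        small  : α s < t

    stops? : ∀ b s → Dec (Stops b s)
    stops? b s = map′ (λ (b≡true , α<t) → stops b≡true α<t) (λ (stops b≡true α<t) → b≡true , α<t)
                      ((b Bool.≟ true) ×-dec (α s <? t))

    mutual
      colour : Tree → V → ℕ × ℕ
      colour (leaf _)    _ = 0 , 0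
      colour (node M ts) v = colourAmong (depthList ts) (M a a) ts v

      colourAmong : ℕ → Bool → List Tree → V → ℕ × ℕ
      colourAmong _ _ []       _ = 0 , 0
      colourAmong h b (s ∷ ts) v with v ∈? leaves s
      ... | yes _ = colourIn h b s v
      ... | no  _ = colourAmong h b ts v

      colourIn : ℕ → Bool → Tree → V → ℕ × ℕ
      colourIn h b s v with stops? b s
      ... | yes _ = suc h , cliqueIndex s v
      ... | no  _ = colour s v

    colourAmong-lookup : ∀ h b ts → Unique (leavesList ts) → ∀ i {v} → v ∈ leaves (lookup ts i) →
                         colourAmong h b ts v ≡ colourIn h b (lookup ts i) v
    colourAmong-lookup h b (s ∷ ts) _ zero {v} v∈ with v ∈? leaves s
    ... | yes _   = refl
    ... | no  v∉s = contradiction v∈ v∉s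
    colourAmong-lookup h b (s ∷ ts) u (suc i) {v} v∈ with v ∈? leaves s
    ... | yes v∈s = ⊥-elim (Unique-++⇒Disjoint (leaves s) u (v∈s , ∈-leavesList⁺ ts i v∈))
    ... | no  _   = colourAmong-lookup h b ts (Unique-++⁻ʳ (leaves s) u) i v∈

    colourAt : (M : Λ → Λ → Bool) (ts : List Tree) → Fin (length ts) → V → ℕ × ℕ
    colourAt M ts i = colourIn (depthList ts) (M a a) (lookup ts i)

    colour-lookup : ∀ {M ts} → IsModel (node M ts) → ∀ i {v} → v ∈ leaves (lookup ts i) →
                    colour (node M ts) v ≡ colourAt M ts i v
    colour-lookup {M} {ts} m = colourAmong-lookup (depthList ts) (M a a) ts (leaves-unique m)

    colourIn-stops : ∀ {h b s v} → Stops b s → colourIn h b s v ≡ (suc h , cliqueIndex s v)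
    colourIn-stops {b = b} {s} st with stops? b s
    ... | yes _  = refl
    ... | no ¬st = contradiction st ¬st

    colour-bounded : ∀ s → IsModel s → ∀ {v} → v ∈ₐ s →
                     proj₁ (colour s v) ≤ depth s × proj₂ (colour s v) ≤ t
    colour-bounded = RTree-ind Bounded (λ _ _ _ → z≤n , z≤n) node-case
      where
      Bounded : Tree → Set
      Bounded s = IsModel s → ∀ {v} → v ∈ₐ s → proj₁ (colour s v) ≤ depth s × proj₂ (colour s v) ≤ t

      node-case : ∀ M ts → (∀ i → Bounded (lookup ts i)) → Bounded (node M ts)
      node-case M ts ih m (v∈ , lv) with childContaining ts v∈
      ... | i , v∈ᵢ rewrite colour-lookup m i v∈ᵢ with stops? (M a a) (lookup ts i)
      ...   | yes (stops _ α<t) = ≤-refl , <⇒≤ (<-trans (cliqueIndex<α (lookup ts i) v∈ᵢ lv) α<t)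
      ...   | no  _ with ih i (IsModel-lookup m i) (v∈ᵢ , lv)
      ...     | height≤ , index≤ = m≤n⇒m≤1+n (≤-trans height≤ (depth-lookup ts i)) , index≤

    continues⇒large : ∀ {b s} → b ≡ true → ¬ Stops b s → t ≤ α s
    continues⇒large b≡true ¬st = ≮⇒≥ (λ α<t → ¬st (stops b≡true α<t))

    equalColoursAcrossJoin⇒stops : ∀ {M ts} → IsModel (node M ts) → M a a ≡ true → ∀ {i j} → i ≢ j →
                                   ∀ {u v} → u ∈ₐ lookup ts i → v ∈ₐ lookup ts j →
                                   colourAt M ts i u ≡ colourAt M ts j v → Stops (M a a) (lookup ts i)
    equalColoursAcrossJoin⇒stops {M} {ts} m Maa {i} {j} i≢j u∈ₐ _ e
      with stops? (M a a) (lookup ts i) | stops? (M a a) (lookup ts j)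
    ... | yes stᵢ | _       = stᵢ
    ... | no ¬stᵢ | yes stⱼ =
      contradiction (≤-trans (≤-reflexive (≡.sym (cong proj₁ e)))
                             (≤-trans (proj₁ (colour-bounded _ (IsModel-lookup m i) u∈ₐ)) (depth-lookup ts i)))
                    1+n≰n
    ... | no ¬stᵢ | no ¬stⱼ =
      ⊥-elim (Ktt-free (large-join-children⇒Ktt t m Maa i≢j
                          (continues⇒large Maa ¬stᵢ) (continues⇒large Maa ¬stⱼ)))

    stopped⇒adj : ∀ {M ts} → IsModel (node M ts) → ∀ i → Stops (M a a) (lookup ts i) →
                  ∀ {u w} → u ∈ₐ lookup ts i → w ∈ₐ lookup ts i →
                  colourAt M ts i u ≡ colourAt M ts i w → u ≢ w → adj G u w ≡ true
    stopped⇒adj {ts = ts} m i st u∈ w∈ e =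
      sameCliqueIndex⇒adj (lookup ts i) (IsModel-lookup m i) u∈ w∈
        (cong proj₂ (trans (≡.sym (colourIn-stops st)) (trans e (colourIn-stops st))))

    colourAt-P₃Free : ∀ {M ts} → IsModel (node M ts) →
                      (∀ i → P₃FreeOn G (_∈ₐ lookup ts i) (colour (lookup ts i))) →
                      ∀ {iu iv iw u v w} → u ∈ₐ lookup ts iu → v ∈ₐ lookup ts iv → w ∈ₐ lookup ts iw →
                      colourAt M ts iu u ≡ colourAt M ts iv v → colourAt M ts iw w ≡ colourAt M ts iv v →
                      adj G u v ≡ true → adj G v w ≡ true → u ≢ w → adj G u w ≡ true
    colourAt-P₃Free {M} {ts} m ih {iu} {iv} {iw} u∈ v∈ w∈ uv wv u~v v~w u≢w with iu Fin.≟ iw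
    ... | no iu≢iw = trans (adj-acrossₐ m iu≢iw u∈ w∈) join
      where
      join : M a a ≡ true
      join with iv Fin.≟ iu
      ... | yes refl = trans (≡.sym (adj-acrossₐ m iu≢iw v∈ w∈)) v~w
      ... | no iv≢iu = trans (≡.sym (adj-acrossₐ m (λ e → iv≢iu (≡.sym e)) u∈ v∈)) u~v
    ... | yes refl with iv Fin.≟ iu
    ...   | no iv≢iu =
      stopped⇒adj m iu (equalColoursAcrossJoin⇒stops m join iu≢iv u∈ v∈ uv) u∈ w∈ (trans uv (≡.sym wv)) u≢w
      where
      iu≢iv : iu ≢ iv
      iu≢iv e = iv≢iu (≡.sym e)
      join : M a a ≡ true
      join = trans (≡.sym (adj-acrossₐ m iu≢iv u∈ v∈)) u~v
    ...   | yes refl with stops? (M a a) (lookup ts iu)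
    ...     | yes _ =
      sameCliqueIndex⇒adj _ (IsModel-lookup m iu) u∈ w∈ (cong proj₂ (trans uv (≡.sym wv))) u≢w
    ...     | no  _ = ih iu u∈ v∈ w∈ uv wv u~v v~w u≢w

    colour-P₃Free : ∀ s → IsModel s → P₃FreeOn G (_∈ₐ s) (colour s)
    colour-P₃Free = RTree-ind P₃ leaf-case node-case
      where
      P₃ : Tree → Set
      P₃ s = IsModel s → P₃FreeOn G (_∈ₐ s) (colour s)

      leaf-case : ∀ x → P₃ (leaf x)
      leaf-case _ _ (here refl , _) _ (here refl , _) _ _ _ _ u≢w = contradiction refl u≢w

      node-case : ∀ M ts → (∀ i → P₃ (lookup ts i)) → P₃ (node M ts)
      node-case M ts ih m (u∈ , lu) (v∈ , lv) (w∈ , lw) uv wv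
        with childContaining ts u∈ | childContaining ts v∈ | childContaining ts w∈
      ... | iu , u∈ᵢ | iv , v∈ᵢ | iw , w∈ᵢ =
        colourAt-P₃Free m (λ i → ih i (IsModel-lookup m i)) (u∈ᵢ , lu) (v∈ᵢ , lv) (w∈ᵢ , lw)
          (atChildren u∈ᵢ v∈ᵢ uv) (atChildren w∈ᵢ v∈ᵢ wv)
        where
        atChildren : ∀ {x y ix iy} → x ∈ leaves (lookup ts ix) → y ∈ leaves (lookup ts iy) →
                     colour (node M ts) x ≡ colour (node M ts) y → colourAt M ts ix x ≡ colourAt M ts iy y
        atChildren x∈ y∈ e = trans (≡.sym (colour-lookup m _ x∈)) (trans e (colour-lookup m _ y∈))

module _ {t d m : ℕ} {G : Graph} (CM : ConnectionModel G (Fin m)) (depth≤d : depth (tree CM) ≤ d)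
         (Ktt-free : ¬ ContainsInducedKtt t G) where

  open Model G Fin._≟_ (label CM)
  open Colouring t Ktt-free

  isModel : IsModel (tree CM)
  isModel = record
    { lca-correct   = correct CM
    ; leaves-unique =
        Permutation.Unique-resp-↭ (≡.setoid _) (↭⇒↭ₛ (↭-sym (leafSet CM))) (Unique.allFin⁺ (n G))
    }

  ∈-tree : ∀ v → v ∈ leaves (tree CM)
  ∈-tree v = ∈-resp-↭ (↭-sym (leafSet CM)) (∈-allFin v)

  labelledColour : Fin (n G) → Fin m × ℕ × ℕ
  labelledColour v = label CM v , colour (label CM v) (tree CM) v

  labelledColour-P₃Free : P₃Free G labelledColour
  labelledColour-P₃Free {u} {v} {w} _ _ _ uv wv =
    colour-P₃Free (label CM v) (tree CM) isModel (∈-tree u , lu) (∈-tree v , refl) (∈-tree w , lw)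
      (relabel lu (,-injectiveʳ uv)) (relabel lw (,-injectiveʳ wv))
    where
    lu : label CM u ≡ label CM v
    lu = ,-injectiveˡ uv
    lw : label CM w ≡ label CM v
    lw = ,-injectiveˡ wv
    relabel : ∀ {x c} → label CM x ≡ label CM v → colour (label CM x) (tree CM) x ≡ c →
              colour (label CM v) (tree CM) x ≡ c
    relabel {x} {c} lx = subst (λ b → colour b (tree CM) x ≡ c) lx

  subcolouring : Fin (n G) → Fin (m * (suc d * suc t))
  subcolouring v = combine (label CM v) (combine (fromℕ< height<) (fromℕ< index<))
    where
    colourᵥ : ℕ × ℕ
    colourᵥ = colour (label CM v) (tree CM) v
    bounds : proj₁ colourᵥ ≤ depth (tree CM) × proj₂ colourᵥ ≤ t
    bounds = colour-bounded (label CM v) (tree CM) isModel (∈-tree v , refl)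
    height< : proj₁ colourᵥ < suc d
    height< = s≤s (≤-trans (proj₁ bounds) depth≤d)
    index< : proj₂ colourᵥ < suc t
    index< = s≤s (proj₂ bounds)

  subcolouring⇒labelledColour : ∀ {u v} → subcolouring u ≡ subcolouring v →
                                labelledColour u ≡ labelledColour v
  subcolouring⇒labelledColour e with combine-injective _ _ _ _ e
  ... | lu≡lv , e′ with combine-injective _ _ _ _ e′
  ...   | height≡ , index≡ =
    cong₂ _,_ lu≡lv (cong₂ _,_ (fromℕ<-injective _ _ _ _ height≡) (fromℕ<-injective _ _ _ _ index≡))

  subcolouring-isSubcoloring : IsSubcoloring G subcolouring
  subcolouring-isSubcoloring =
    P₃Free⇒IsSubcoloring G (P₃Free-refine G subcolouring⇒labelledColour labelledColour-P₃Free)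

lemma3p9 : (t : ℕ) (𝒟 : GraphClass) → BoundedShrubdepth 𝒟 →
           (∀ G → 𝒟 G → ¬ ContainsInducedKtt t G) →
           BoundedSubchromatic 𝒟
lemma3p9 t 𝒟 (d , m , models) Ktt-free =
  m * (suc d * suc t) , λ G G∈𝒟 →
    let (CM , depth≤d) = models G G∈𝒟 in
    subcolouring CM depth≤d (Ktt-free G G∈𝒟) , subcolouring-isSubcoloring CM depth≤d (Ktt-free G G∈𝒟)
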